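{- Let $n$ be a power of two, $\alpha\in(0,1)$ with $n^{1-\alpha}$ a power of two, $\delta>0$, and let $A,B$ be $n\times n$ $\delta$-bounded-difference matrices. For $i,j,k_1,k_2\in[n]$, if $k_1',k_2'\in K(i',j')$, then $$|A_{i,k_1}+B_{k_1,j}-A_{i,k_2}-B_{k_2,j}|\le 16\delta n^{1-\alpha}.$$
   Context: A matrix $X$ is $\delta$-bounded-difference if for all $i,j$ (whenever the entries exist) $|X_{i,j}-X_{i,j+1}|<\delta$ and $|X_{i,j}-X_{i+1,j}|<\delta$. $[n]=\{1,\dots,n\}$. Partition $[n]$ into consecutive intervals of length $n^{1-\alpha}$; for $i\in[n]$, $I(i)$ is the interval containing $i$ and $i'$ is the smallest element of $I(i)$ (similarly $j',k'$). Let $[n]'=\{1,n^{1-\alpha}+1,\dots,n-n^{1-\alpha}+1\}$, $\tilde C_{i,j}=\min_{k'\in[n]'}\{A_{i',k'}+B_{k',j'}\}$, and $K(i',j')=\{k'\in[n]' : A_{i',k'}+B_{k',j'}\le \tilde C_{i',j'}+8\delta n^{1-\alpha}\}$.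
   Formalization: The entries of the matrices A and B and the parameter δ are rational. -}

module Defs where

open import Data.Nat as ℕ using (ℕ; suc; _^_; NonZero)
open import Data.Nat.DivMod using (_/_; m/n*n≤m)
open import Data.Nat.Properties using (≤-<-trans)
open import Data.Fin using (Fin; toℕ; fromℕ<)
open import Data.Fin.Properties using (toℕ<n)
open import Data.List using (List; []; _∷_; map; foldr; allFin)
open import Data.List.Membership.Propositional using (_∈_)
open import Data.Integer using (+_)
open import Data.Rational as ℚ using (ℚ; _+_; _*_; _-_; _⊓_; ∣_∣; _≤_; _<_)
open import Data.Product using (_×_)

-- n × n matrices with rational entries (indices 0-based: Fin n ≅ [n])
Mat : ℕ → Set
Mat n = Fin n → Fin n → ℚ

ℕ→ℚ : ℕ → ℚ
ℕ→ℚ k = (+ k) ℚ./ 1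

BoundedDifference : {n : ℕ} → ℚ → Mat n → Set
BoundedDifference {n} δ X =
  (∀ (i j j₂ : Fin n) → toℕ j₂ ≡ suc (toℕ j) → ∣ X i j - X i j₂ ∣ < δ) ×
  (∀ (i i₂ j : Fin n) → toℕ i₂ ≡ suc (toℕ i) → ∣ X i j - X i₂ j ∣ < δ)
  where open import Relation.Binary.PropositionalEquality using (_≡_)

-- i' : the smallest element of the length-m interval containing i
blockStart : {n : ℕ} (m : ℕ) .{{_ : NonZero m}} → Fin n → Fin n
blockStart {n} m i = fromℕ< (≤-<-trans (m/n*n≤m (toℕ i) m) (toℕ<n i))

blockStarts : (n m : ℕ) .{{_ : NonZero m}} → List (Fin n)
blockStarts n m = map (blockStart m) (allFin n)

-- minimum of a list of rationals (the empty case never arises below, n ≥ 1)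
minList : List ℚ → ℚ
minList [] = ℚ.0ℚ
minList (x ∷ xs) = foldr _⊓_ x xs

Ctilde : {n : ℕ} (m : ℕ) .{{_ : NonZero m}} → Mat n → Mat n → Fin n → Fin n → ℚ
Ctilde {n} m A B i' j' = minList (map (λ k' → A i' k' + B k' j') (blockStarts n m))

InK : {n : ℕ} (m : ℕ) .{{_ : NonZero m}} → ℚ → Mat n → Mat n → Fin n → Fin n → Fin n → Set
InK {n} m δ A B i' j' k' =
  k' ∈ blockStarts n m ×
  A i' k' + B k' j' ≤ Ctilde m A B i' j' + ℕ→ℚ 8 * δ * ℕ→ℚ m

-- A chain of h unit steps in a δ-bounded-difference matrix changes an entry by at most h δ,
-- so moving (i, k, j) to the block starts (i', k', j') perturbs A_{i,k} + B_{k,j} by at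
-- most 4 δ n^{1-α}.  Two members of K(i', j') lie in the window [C̃, C̃ + 8 δ n^{1-α}], so
-- their block costs differ by at most 8 δ n^{1-α}; the triangle inequality adds up to 16.
module Submission where

open import Defs
open import Data.Nat as ℕ using (ℕ; _^_; NonZero)
open import Data.Nat.DivMod using (_%_; m≡m%n+[m/n]*n; m%n<n)
open import Data.Nat.Coprimality using (1-coprimeTo; sym)
import Data.Nat.Properties as ℕ
open import Data.Integer as ℤ using (+_)
import Data.Integer.Properties as ℤ
open import Data.Fin using (Fin; toℕ; fromℕ<)
open import Data.Fin.Properties using (toℕ-fromℕ<; toℕ-injective; toℕ<n)
open import Data.List using ([]; _∷_; foldr)
open import Data.List.Membership.Propositional using (_∈_)
open import Data.List.Membership.Propositional.Properties using (∈-map⁺)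
open import Data.List.Relation.Unary.Any using (here; there)
open import Data.Product using (_×_; _,_; proj₁; proj₂)
open import Data.Sum using (_⊎_; inj₁; inj₂)
open import Relation.Binary.PropositionalEquality using (_≡_; refl; cong; subst; subst₂)
  renaming (sym to ≡-sym; trans to ≡-trans)
open import Data.Rational as ℚ
  using (ℚ; mkℚ; _+_; _*_; _-_; ∣_∣; _⊓_; _≤_; _<_; *≤*; Positive; NonNegative)
open import Data.Rational.Properties
open import Data.Rational.Solver using (module +-*-Solver)
open +-*-Solver

ℕ→ℚ≡mkℚ : ∀ k → ℕ→ℚ k ≡ mkℚ (+ k) 0 (sym (1-coprimeTo k))
ℕ→ℚ≡mkℚ k = normalize-coprime (sym (1-coprimeTo k))

ℕ→ℚ-suc : ∀ k → ℕ→ℚ (ℕ.suc k) ≡ ℚ.1ℚ + ℕ→ℚ k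
ℕ→ℚ-suc k rewrite ℕ→ℚ≡mkℚ k =
  /-cong {+ ℕ.suc k} {1} {+ 1 ℤ.+ + k ℤ.* + 1} {1}
    (≡-sym (cong (λ z → + 1 ℤ.+ z) (ℤ.*-identityʳ (+ k)))) refl

ℕ→ℚ-mono-≤ : ∀ {t u} → t ℕ.≤ u → ℕ→ℚ t ≤ ℕ→ℚ u
ℕ→ℚ-mono-≤ {t} {u} t≤u rewrite ℕ→ℚ≡mkℚ t | ℕ→ℚ≡mkℚ u =
  *≤* (subst₂ ℤ._≤_ (≡-sym (ℤ.*-identityʳ (+ t))) (≡-sym (ℤ.*-identityʳ (+ u))) (ℤ.+≤+ t≤u))

∣p-q∣≡∣q-p∣ : ∀ p q → ∣ p - q ∣ ≡ ∣ q - p ∣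
∣p-q∣≡∣q-p∣ p q = ≡-trans (≡-sym (∣-p∣≡∣p∣ (p - q)))
  (cong ∣_∣ (solve 2 (λ p q → :- (p :- q) := q :- p) refl p q))

∣p-r∣≤∣p-q∣+∣q-r∣ : ∀ p q r → ∣ p - r ∣ ≤ ∣ p - q ∣ + ∣ q - r ∣
∣p-r∣≤∣p-q∣+∣q-r∣ p q r = subst (λ x → ∣ x ∣ ≤ ∣ p - q ∣ + ∣ q - r ∣)
  (solve 3 (λ p q r → (p :- q) :+ (q :- r) := p :- r) refl p q r)
  (∣p+q∣≤∣p∣+∣q∣ (p - q) (q - r))

∣p-s∣≤∣p-q∣+∣q-r∣+∣r-s∣ : ∀ p q r s → ∣ p - s ∣ ≤ ∣ p - q ∣ + ∣ q - r ∣ + ∣ r - s ∣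
∣p-s∣≤∣p-q∣+∣q-r∣+∣r-s∣ p q r s = ≤-trans (∣p-r∣≤∣p-q∣+∣q-r∣ p r s)
  (+-monoˡ-≤ ∣ r - s ∣ (∣p-r∣≤∣p-q∣+∣q-r∣ p q r))

∣p+q-r+s∣≤∣p-r∣+∣q-s∣ : ∀ p q r s → ∣ (p + q) - (r + s) ∣ ≤ ∣ p - r ∣ + ∣ q - s ∣
∣p+q-r+s∣≤∣p-r∣+∣q-s∣ p q r s = subst (λ x → ∣ x ∣ ≤ ∣ p - r ∣ + ∣ q - s ∣)
  (solve 4 (λ p q r s → (p :- r) :+ (q :- s) := (p :+ q) :- (r :+ s)) refl p q r s)
  (∣p+q∣≤∣p∣+∣q∣ (p - r) (q - s))

p+q-p≡q : ∀ p q → (p + q) - p ≡ q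
p+q-p≡q = solve 2 (λ p q → (p :+ q) :- p := q) refl

window⇒∣p-q∣≤ : ∀ c e p q → c ≤ p → p ≤ c + e → c ≤ q → q ≤ c + e → ∣ p - q ∣ ≤ e
window⇒∣p-q∣≤ c e p q c≤p p≤c+e c≤q q≤c+e with ∣p∣≡p∨∣p∣≡-p (p - q)
... | inj₁ ∣p-q∣≡p-q rewrite ∣p-q∣≡p-q = ≤-trans (+-mono-≤ p≤c+e (neg-antimono-≤ c≤q)) (≤-reflexive (p+q-p≡q c e))
... | inj₂ ∣p-q∣≡q-p rewrite ∣p-q∣≡q-p = ≤-trans
  (≤-reflexive (solve 2 (λ p q → :- (p :- q) := q :- p) refl p q))
  (≤-trans (+-mono-≤ q≤c+e (neg-antimono-≤ c≤p)) (≤-reflexive (p+q-p≡q c e)))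

minList-≤ : ∀ xs {y} → y ∈ xs → minList xs ≤ y
minList-≤ (x ∷ xs) = foldr-⊓-≤ x xs
  where
  foldr-⊓-≤ : ∀ x xs {y} → y ∈ x ∷ xs → foldr _⊓_ x xs ≤ y
  foldr-⊓-≤ x [] (here refl) = ≤-refl
  foldr-⊓-≤ x (z ∷ zs) (here refl) = p≤q⇒r⊓p≤q z (foldr-⊓-≤ x zs (here refl))
  foldr-⊓-≤ x (z ∷ zs) (there (here refl)) = p⊓q≤p z _
  foldr-⊓-≤ x (z ∷ zs) (there (there y∈zs)) = p≤q⇒r⊓p≤q z (foldr-⊓-≤ x zs (there y∈zs))

AdjacentBounded : {n : ℕ} → ℚ → (Fin n → ℚ) → Set
AdjacentBounded δ f = ∀ j j₂ → toℕ j₂ ≡ ℕ.suc (toℕ j) → ∣ f j - f j₂ ∣ < δ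

module _ {n : ℕ} {δ : ℚ} (f : Fin n → ℚ) (adj : AdjacentBounded δ f) where

  ∣f-f∣≤distance*δ : ∀ t (a b : Fin n) → toℕ b ≡ t ℕ.+ toℕ a → ∣ f b - f a ∣ ≤ ℕ→ℚ t * δ
  ∣f-f∣≤distance*δ ℕ.zero a b b≡a with toℕ-injective b≡a
  ... | refl = ≤-reflexive (≡-trans (cong ∣_∣ (+-inverseʳ (f a))) (≡-sym (*-zeroˡ δ)))
  ∣f-f∣≤distance*δ (ℕ.suc t) a b b≡1+t+a = begin
    ∣ f b - f a ∣                  ≤⟨ ∣p-r∣≤∣p-q∣+∣q-r∣ (f b) (f c) (f a) ⟩
    ∣ f b - f c ∣ + ∣ f c - f a ∣  ≤⟨ +-mono-≤ last-step (∣f-f∣≤distance*δ t a c (toℕ-fromℕ< t+a<n)) ⟩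
    δ + ℕ→ℚ t * δ                  ≡⟨ solve 2 (λ x d → d :+ x :* d := (con ℚ.1ℚ :+ x) :* d) refl (ℕ→ℚ t) δ ⟩
    (ℚ.1ℚ + ℕ→ℚ t) * δ             ≡⟨ cong (_* δ) (ℕ→ℚ-suc t) ⟨
    ℕ→ℚ (ℕ.suc t) * δ              ∎
    where
    open ≤-Reasoning
    t+a<n : t ℕ.+ toℕ a ℕ.< n
    t+a<n = ℕ.<-trans (ℕ.n<1+n _) (subst (ℕ._< n) b≡1+t+a (toℕ<n b))
    c : Fin n
    c = fromℕ< t+a<n
    last-step : ∣ f b - f c ∣ ≤ δ
    last-step = subst (_≤ δ) (∣p-q∣≡∣q-p∣ (f c) (f b))
      (<⇒≤ (adj c b (≡-trans b≡1+t+a (cong ℕ.suc (≡-sym (toℕ-fromℕ< t+a<n))))))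

  ∣f-f∘blockStart∣≤m*δ : .{{_ : NonNegative δ}} (m : ℕ) .{{_ : NonZero m}} (x : Fin n) →
                         ∣ f x - f (blockStart m x) ∣ ≤ ℕ→ℚ m * δ
  ∣f-f∘blockStart∣≤m*δ m x = ≤-trans
    (∣f-f∣≤distance*δ (toℕ x % m) (blockStart m x) x x≡r+x')
    (*-monoʳ-≤-nonNeg δ (ℕ→ℚ-mono-≤ (ℕ.<⇒≤ (m%n<n (toℕ x) m))))
    where
    x≡r+x' : toℕ x ≡ toℕ x % m ℕ.+ toℕ (blockStart m x)
    x≡r+x' = ≡-trans (m≡m%n+[m/n]*n (toℕ x) m) (cong (toℕ x % m ℕ.+_) (≡-sym (toℕ-fromℕ< _)))

rowsAdjacentBounded : ∀ {n δ} (X : Mat n) → BoundedDifference δ X → ∀ i → AdjacentBounded δ (X i)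
rowsAdjacentBounded X bd i = proj₁ bd i

columnsAdjacentBounded : ∀ {n δ} (X : Mat n) → BoundedDifference δ X → ∀ j → AdjacentBounded δ (λ i → X i j)
columnsAdjacentBounded X bd j i i₂ = proj₂ bd i i₂ j

∣X-X∘blockStart∣≤2m*δ : ∀ {n δ} .{{_ : NonNegative δ}} (X : Mat n) → BoundedDifference δ X →
                        (m : ℕ) .{{_ : NonZero m}} (i k : Fin n) →
                        ∣ X i k - X (blockStart m i) (blockStart m k) ∣ ≤ ℕ→ℚ m * δ + ℕ→ℚ m * δ
∣X-X∘blockStart∣≤2m*δ X bd m i k = ≤-trans
  (∣p-r∣≤∣p-q∣+∣q-r∣ (X i k) (X (blockStart m i) k) (X (blockStart m i) (blockStart m k)))
  (+-mono-≤ (∣f-f∘blockStart∣≤m*δ (λ i → X i k) (columnsAdjacentBounded X bd k) m i)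
            (∣f-f∘blockStart∣≤m*δ (X (blockStart m i)) (rowsAdjacentBounded X bd (blockStart m i)) m k))

∣cost-cost∘blockStart∣≤4δm : ∀ {n δ} .{{_ : NonNegative δ}} (A B : Mat n) →
    BoundedDifference δ A → BoundedDifference δ B → (m : ℕ) .{{_ : NonZero m}} (i k j : Fin n) →
    ∣ (A i k + B k j) - (A (blockStart m i) (blockStart m k) + B (blockStart m k) (blockStart m j)) ∣
      ≤ ℕ→ℚ 4 * δ * ℕ→ℚ m
∣cost-cost∘blockStart∣≤4δm {n} {δ} A B bdA bdB m i k j = begin
  ∣ (A i k + B k j) - (A i' k' + B k' j') ∣  ≤⟨ ∣p+q-r+s∣≤∣p-r∣+∣q-s∣ (A i k) (B k j) (A i' k') (B k' j') ⟩
  ∣ A i k - A i' k' ∣ + ∣ B k j - B k' j' ∣  ≤⟨ +-mono-≤ (∣X-X∘blockStart∣≤2m*δ A bdA m i k) (∣X-X∘blockStart∣≤2m*δ B bdB m k j) ⟩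
  (mδ + mδ) + (mδ + mδ)                      ≡⟨ solve 2 (λ M d → (M :* d :+ M :* d) :+ (M :* d :+ M :* d) := con (ℕ→ℚ 4) :* d :* M) refl (ℕ→ℚ m) δ ⟩
  ℕ→ℚ 4 * δ * ℕ→ℚ m                         ∎
  where
  open ≤-Reasoning
  i' k' j' : Fin n
  i' = blockStart m i
  k' = blockStart m k
  j' = blockStart m j
  mδ : ℚ
  mδ = ℕ→ℚ m * δ

Ctilde-≤ : ∀ {n} (m : ℕ) .{{_ : NonZero m}} (A B : Mat n) (i' j' : Fin n) {k'} →
           k' ∈ blockStarts n m → Ctilde m A B i' j' ≤ A i' k' + B k' j'
Ctilde-≤ m A B i' j' k'∈ = minList-≤ _ (∈-map⁺ (λ k' → A i' k' + B k' j') k'∈)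

InK-close : ∀ {n} (m : ℕ) .{{_ : NonZero m}} δ (A B : Mat n) (i' j' k₁' k₂' : Fin n) →
            InK m δ A B i' j' k₁' → InK m δ A B i' j' k₂' →
            ∣ (A i' k₁' + B k₁' j') - (A i' k₂' + B k₂' j') ∣ ≤ ℕ→ℚ 8 * δ * ℕ→ℚ m
InK-close m δ A B i' j' k₁' k₂' (k₁'∈ , k₁'-near) (k₂'∈ , k₂'-near) =
  window⇒∣p-q∣≤ (Ctilde m A B i' j') _ _ _
    (Ctilde-≤ m A B i' j' k₁'∈) k₁'-near (Ctilde-≤ m A B i' j' k₂'∈) k₂'-near

lemma2 : (n m p q : ℕ) .{{_ : NonZero m}} →
    n ≡ 2 ^ p → m ≡ 2 ^ q →
    ((0 ℕ.< q × q ℕ.< p) ⊎ (p ≡ 0 × q ≡ 0)) →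
    (δ : ℚ) → Positive δ →
    (A B : Mat n) →
    BoundedDifference δ A → BoundedDifference δ B →
    (i j k₁ k₂ : Fin n) →
    InK m δ A B (blockStart m i) (blockStart m j) (blockStart m k₁) →
    InK m δ A B (blockStart m i) (blockStart m j) (blockStart m k₂) →
    ∣ A i k₁ + B k₁ j - A i k₂ - B k₂ j ∣ ≤ ℕ→ℚ 16 * δ * ℕ→ℚ m
lemma2 n m _ _ _ _ _ δ δ>0 A B bdA bdB i j k₁ k₂ k₁'∈K k₂'∈K = begin
  ∣ A i k₁ + B k₁ j - A i k₂ - B k₂ j ∣         ≡⟨ cong ∣_∣ (solve 4 (λ a b c d → a :+ b :- c :- d := (a :+ b) :- (c :+ d)) refl (A i k₁) (B k₁ j) (A i k₂) (B k₂ j)) ⟩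
  ∣ cost k₁ - cost k₂ ∣                         ≤⟨ ∣p-s∣≤∣p-q∣+∣q-r∣+∣r-s∣ (cost k₁) (blockCost k₁) (blockCost k₂) (cost k₂) ⟩
  ∣ cost k₁ - blockCost k₁ ∣ + ∣ blockCost k₁ - blockCost k₂ ∣ + ∣ blockCost k₂ - cost k₂ ∣
                                                ≤⟨ +-mono-≤ (+-mono-≤ (cost-near k₁) (InK-close m δ A B _ _ _ _ k₁'∈K k₂'∈K))
                                                            (subst (_≤ ℕ→ℚ 4 * δ * M) (∣p-q∣≡∣q-p∣ (cost k₂) (blockCost k₂)) (cost-near k₂)) ⟩
  ℕ→ℚ 4 * δ * M + ℕ→ℚ 8 * δ * M + ℕ→ℚ 4 * δ * M  ≡⟨ solve 2 (λ M d → con (ℕ→ℚ 4) :* d :* M :+ con (ℕ→ℚ 8) :* d :* M :+ con (ℕ→ℚ 4) :* d :* M := con (ℕ→ℚ 16) :* d :* M) refl M δ ⟩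
  ℕ→ℚ 16 * δ * M                                ∎
  where
  open ≤-Reasoning
  instance δ≥0 : NonNegative δ
  δ≥0 = pos⇒nonNeg δ {{δ>0}}
  M : ℚ
  M = ℕ→ℚ m
  cost blockCost : Fin n → ℚ
  cost k = A i k + B k j
  blockCost k = A (blockStart m i) (blockStart m k) + B (blockStart m k) (blockStart m j)
  cost-near : ∀ k → ∣ cost k - blockCost k ∣ ≤ ℕ→ℚ 4 * δ * M
  cost-near k = ∣cost-cost∘blockStart∣≤4δm A B bdA bdB m i k j
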